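{- Let $G$ be an MP-digraph. Then its multipath matroid $M_G$ is isomorphic to a direct sum of uniform matroids.
   Context: Digraphs: finite, at most one edge $(v,w)$ from $v$ to $w$ for distinct $v,w$, finitely many loops allowed at each vertex. A multipath of $G$ is a spanning subgraph each connected component of which is a vertex or a simple path (a sequence of non-loop edges $e_1,\dots,e_n$ with target of $e_i$ = source of $e_{i+1}$, no repeated vertices, not closing into a cycle); $\mathrm{Mult}(G)$ is the set of multipaths identified with their edge sets and $M_G=(E(G),\mathrm{Mult}(G))$. An MP-digraph satisfies (MP1) no subgraph isomorphic to $D_A$ (vertices $v_0,v_1,v_2$, edges $(v_1,v_0),(v_0,v_2),(v_1,v_2)$) or $D_B$ (vertices $v_0,\dots,v_3$, edges $(v_0,v_1),(v_2,v_1),(v_2,v_3)$) or their edge-reversals, and (MP2) every coherently oriented cycle of length $\ge2$ is a connected component; then $M_G$ is a matroid. The uniform matroid $U_{k,n}$ has ground set $\{1,\dots,n\}$ and independent sets all subsets of size at most $k$. Direct sum: ground set the disjoint union, independents the disjoint unions of independents. -}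

module Defs where

open import Level using (0ℓ)
open import Data.Nat using (ℕ; zero; suc; _+_; _≤_)
open import Data.Fin using (Fin; zero; suc; inject₁; fromℕ)
open import Data.Bool using (Bool; true; false)
open import Data.Product using (Σ; ∃; ∃-syntax; _×_; _,_)
open import Data.Sum using (_⊎_)
open import Function.Bundles using (_⇔_; _↔_; Inverse)
open import Function.Definitions using (Injective)
open import Relation.Binary.PropositionalEquality using (_≡_; _≢_)
open import Relation.Nullary using (¬_)

-- Digraphs: vertices Fin n, edges Fin m with source/target maps.
-- At most one edge (v,w) for distinct v,w; any finite number of loops.

record Digraph : Set where
  field
    nV    : ℕ
    nE    : ℕ
    src   : Fin nE → Fin nV
    tgt   : Fin nE → Fin nV
    atMostOne : ∀ e e' → src e ≢ tgt e → src e ≡ src e' → tgt e ≡ tgt e' → e ≡ e'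

module _ (G : Digraph) where
  open Digraph G

  HasEdge : Fin nV → Fin nV → Set
  HasEdge v w = ∃[ e ] (src e ≡ v × tgt e ≡ w)

  record SimplePath : Set where
    field
      len    : ℕ                          -- k = suc len edges
      vert   : Fin (suc (suc len)) → Fin nV
      edge   : Fin (suc len) → Fin nE
      distinct : Injective _≡_ _≡_ vert
      edgeSrc : ∀ i → src (edge i) ≡ vert (inject₁ i)
      edgeTgt : ∀ i → tgt (edge i) ≡ vert (suc i)

  open SimplePath

  -- X (an edge set) is a multipath: the spanning subgraph with edge set X
  -- has every connected component a single vertex or a simple path, i.e.
  -- X is the union of the edge sets of pairwise vertex-disjoint simple paths.
  IsMultipath : (Fin nE → Bool) → Set
  IsMultipath X =
    ∃[ r ] Σ (Fin r → SimplePath) λ P →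
      (∀ i j a b → vert (P i) a ≡ vert (P j) b → i ≡ j)
      × (∀ e → X e ≡ true ⇔ (∃[ i ] ∃[ t ] edge (P i) t ≡ e))

  ContainsDA : Set
  ContainsDA = Σ (Fin 3 → Fin nV) λ v → Injective _≡_ _≡_ v
    × HasEdge (v (suc zero)) (v zero)
    × HasEdge (v zero) (v (suc (suc zero)))
    × HasEdge (v (suc zero)) (v (suc (suc zero)))

  ContainsDArev : Set
  ContainsDArev = Σ (Fin 3 → Fin nV) λ v → Injective _≡_ _≡_ v
    × HasEdge (v zero) (v (suc zero))
    × HasEdge (v (suc (suc zero))) (v zero)
    × HasEdge (v (suc (suc zero))) (v (suc zero))

  ContainsDB : Set
  ContainsDB = Σ (Fin 4 → Fin nV) λ v → Injective _≡_ _≡_ v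
    × HasEdge (v zero) (v (suc zero))
    × HasEdge (v (suc (suc zero))) (v (suc zero))
    × HasEdge (v (suc (suc zero))) (v (suc (suc (suc zero))))

  ContainsDBrev : Set
  ContainsDBrev = Σ (Fin 4 → Fin nV) λ v → Injective _≡_ _≡_ v
    × HasEdge (v (suc zero)) (v zero)
    × HasEdge (v (suc zero)) (v (suc (suc zero)))
    × HasEdge (v (suc (suc (suc zero)))) (v (suc (suc zero)))

  MP1 : Set
  MP1 = ¬ ContainsDA × ¬ ContainsDArev × ¬ ContainsDB × ¬ ContainsDBrev

  -- a coherently oriented cycle c_0 → c_1 → … → c_{k-1} → c_0 of length
  -- k = suc (suc len) ≥ 2 with distinct vertices
  record Cycle : Set where
    field
      len   : ℕ
      vert  : Fin (suc (suc len)) → Fin nV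
      distinct : Injective _≡_ _≡_ vert
      step  : ∀ (i : Fin (suc len)) → HasEdge (vert (inject₁ i)) (vert (suc i))
      close : HasEdge (vert (fromℕ (suc len))) (vert zero)

  -- the cycle (as a subgraph) is a connected component of G: every edge
  -- incident to a vertex of the cycle is one of the cycle's edges
  IsComponent : Cycle → Set
  IsComponent C =
    ∀ e → (∃[ a ] src e ≡ Cycle.vert C a) ⊎ (∃[ a ] tgt e ≡ Cycle.vert C a) →
      (∃[ i ] (src e ≡ Cycle.vert C (inject₁ i) × tgt e ≡ Cycle.vert C (suc i)))
      ⊎ (src e ≡ Cycle.vert C (fromℕ (suc (Cycle.len C))) × tgt e ≡ Cycle.vert C zero)

  MP2 : Set
  MP2 = ∀ (C : Cycle) → IsComponent C

IsMPDigraph : Digraph → Set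
IsMPDigraph G = MP1 G × MP2 G

record SetSystem : Set₁ where
  field
    Ground : Set
    Indep  : (Ground → Bool) → Set

open SetSystem public

multipathMatroid : Digraph → SetSystem
multipathMatroid G = record { Ground = Fin (Digraph.nE G) ; Indep = IsMultipath G }

card : ∀ {n} → (Fin n → Bool) → ℕ
card {zero}  X = 0
card {suc n} X with X zero
... | true  = suc (card (λ i → X (suc i)))
... | false = card (λ i → X (suc i))

uniform : ℕ → ℕ → SetSystem
uniform k n = record { Ground = Fin n ; Indep = λ X → card X ≤ k }

directSum : ∀ {r} → (Fin r → SetSystem) → SetSystem
directSum {r} M = record
  { Ground = Σ (Fin r) (λ i → Ground (M i))
  ; Indep  = λ X → ∀ i → Indep (M i) (λ x → X (i , x))
  }

_≅_ : SetSystem → SetSystem → Set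
M ≅ N = Σ (Ground M ↔ Ground N) λ φ →
  ∀ (Y : Ground N → Bool) → Indep M (λ x → Y (Inverse.to φ x)) ⇔ Indep N Y

{-# OPTIONS --safe #-}
module Submission where

-- The edges of an MP-digraph fall into classes: each loop on its own, the edge set of each
-- directed cycle (a connected component, by MP2), and, among the remaining edges, the classes
-- of the relation "shares its source or its target with", which is transitive because D_A and
-- D_B are excluded (MP1). An edge set is a multipath iff it is a linear forest: no loops, no two
-- edges with a common source or a common target, and no closed walk. In an MP-digraph this holds
-- iff the set avoids every loop, meets each shared-endpoint class at most once and misses an
-- edge of every cycle, i.e. iff it is independent in the direct sum of the uniform matroids
-- U₀,ₙ, U₁,ₙ and Uₙ₋₁,ₙ on these classes.

open import Defs
open import Level using (0ℓ)
open import Data.Nat as ℕ using (ℕ; zero; suc; _+_; _∸_; _≤_; _<_; z≤n; s≤s; s≤s⁻¹; z<s)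
import Data.Nat.Properties as ℕ
open import Data.Fin as Fin using (Fin; zero; suc; toℕ; inject₁; fromℕ<)
import Data.Fin.Properties as Fin
open import Data.Bool as Bool using (Bool; true; false; T?)
open import Data.Bool.Properties using (T-irrelevant; ¬-not)
open import Data.Empty using (⊥)
open import Data.Product using (Σ; ∃₂; ∃-syntax; _×_; _,_; proj₁; proj₂)
open import Data.Product.Properties using (Σ-≡,≡→≡)
open import Data.Sum using (_⊎_; inj₁; inj₂; [_,_]′)
open import Data.Vec using ([]; _∷_; lookup)
open import Data.Vec.Relation.Unary.All using ([]; _∷_)
open import Data.Vec.Relation.Unary.AllPairs using ([]; _∷_)
open import Data.Vec.Relation.Unary.Unique.Propositional.Properties using (lookup-injective)
open import Function using (_∘_)
open import Function.Bundles using (_⇔_; _↔_; Inverse; Equivalence; mk⇔; mk↔ₛ′)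
open import Function.Construct.Composition using (_⇔-∘_)
open import Function.Construct.Symmetry using (⇔-sym)
open import Function.Definitions using (Injective)
import Function.Endo.Propositional as Endo
open import Relation.Binary.Definitions using (tri<; tri≈; tri>)
open import Relation.Binary.PropositionalEquality
open ≡-Reasoning
open import Relation.Nullary using (¬_; Dec; yes; no; contradiction)
open import Relation.Nullary.Decidable using (_×-dec_; _⊎-dec_; ¬?; isYes; True; toWitness; fromWitness; decidable-stable)
open import Relation.Unary using (Pred; Decidable; Irrelevant)
open import Axiom.UniquenessOfIdentityProofs using (module Decidable⇒UIP)

least-witness : ∀ {m} {P : Pred (Fin m) 0ℓ} → Decidable P → ∀ i → P i →
                Σ (Fin m) λ j → P j × (∀ k → P k → j Fin.≤ k)
least-witness {suc m} P? i pᵢ with P? zero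
... | yes p₀ = zero , p₀ , λ _ _ → z≤n
least-witness {suc m} P? zero    p₀ | no ¬p₀ = contradiction p₀ ¬p₀
least-witness {suc m} P? (suc i) pᵢ | no ¬p₀ with least-witness (P? ∘ suc) i pᵢ
... | j , pⱼ , minimal = suc j , pⱼ , λ { zero p₀ → contradiction p₀ ¬p₀ ; (suc k) pₖ → s≤s (minimal k pₖ) }

all⊎least-counterexample : {P : Pred ℕ 0ℓ} → Decidable P → ∀ n →
  (∀ k → k ≤ n → P k) ⊎ (∃[ m ] m ≤ n × ¬ P m × (∀ k → k < m → P k))
all⊎least-counterexample {P} P? zero with P? zero
... | yes p₀ = inj₁ λ { zero _ → p₀ }
... | no ¬p₀ = inj₂ (zero , z≤n , ¬p₀ , λ _ ())
all⊎least-counterexample {P} P? (suc n) with all⊎least-counterexample P? n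
... | inj₂ (m , m≤n , ¬pₘ , below) = inj₂ (m , ℕ.m≤n⇒m≤1+n m≤n , ¬pₘ , below)
... | inj₁ upto-n with P? (suc n)
...   | no ¬p = inj₂ (suc n , ℕ.≤-refl , ¬p , λ k k<1+n → upto-n k (s≤s⁻¹ k<1+n))
...   | yes p = inj₁ λ k k≤1+n →
  [ (λ k<1+n → upto-n k (s≤s⁻¹ k<1+n)) , (λ k≡1+n → subst P (sym k≡1+n) p) ]′ (ℕ.m≤n⇒m<n∨m≡n k≤1+n)

sequence-repeats : ∀ {n} (w : ℕ → Fin n) → ∃₂ λ i j → i < j × j ≤ n × w i ≡ w j
sequence-repeats {n} w with Fin.pigeonhole (ℕ.n<1+n n) (w ∘ toℕ)
... | i , j , i<j , wᵢ≡wⱼ = toℕ i , toℕ j , i<j , s≤s⁻¹ (Fin.toℕ<n j) , wᵢ≡wⱼ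

repeat-free⇒injective : ∀ {A : Set} {n} (g : ℕ → A) → (∀ {i j} → i < j → j < n → g i ≢ g j) →
                        ∀ {i j} → i < n → j < n → g i ≡ g j → i ≡ j
repeat-free⇒injective g repeat-free {i} {j} i<n j<n gᵢ≡gⱼ with ℕ.<-cmp i j
... | tri< i<j _ _ = contradiction gᵢ≡gⱼ (repeat-free i<j j<n)
... | tri≈ _ i≡j _ = i≡j
... | tri> _ _ j<i = contradiction (sym gᵢ≡gⱼ) (repeat-free j<i i<n)

first-return : ∀ {n} (g : ℕ → Fin n) {q} → 0 < q → g q ≡ g 0 →
               ∃[ c ] 0 < c × c ≤ q × g c ≡ g 0 × (∀ {k} → 0 < k → k < c → g k ≢ g 0)
first-return g {suc q} _ closed with all⊎least-counterexample (λ k → ¬? (g (suc k) Fin.≟ g 0)) q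
... | inj₁ never = contradiction closed (never q ℕ.≤-refl)
... | inj₂ (m , m≤q , returns , before) =
  suc m , z<s , s≤s m≤q , decidable-stable (g (suc m) Fin.≟ g 0) returns ,
  λ { {suc k} _ 1+k<1+m → before k (s≤s⁻¹ 1+k<1+m) }

-- If g i = g j with i < j < c, shifting both by c ∸ j returns to g 0 before time c.
first-return-injective : ∀ {A : Set} (g : ℕ → A) {c} → g c ≡ g 0 → (∀ {k} → 0 < k → k < c → g k ≢ g 0) →
                         (∀ {a b} → a < c → b < c → g a ≡ g b → g (suc a) ≡ g (suc b)) →
                         ∀ {i j} → i < c → j < c → g i ≡ g j → i ≡ j
first-return-injective g {c} closed first deterministic = repeat-free⇒injective g repeat-free
  where
  repeat-free : ∀ {i j} → i < j → j < c → g i ≢ g j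
  repeat-free {i} {j} i<j j<c gᵢ≡gⱼ = first 0<i+d i+d<c (trans (shift d ℕ.≤-refl) (trans (cong g j+d≡c) closed))
    where
    d = c ∸ j
    j+d≡c : j + d ≡ c
    j+d≡c = ℕ.m+[n∸m]≡n (ℕ.<⇒≤ j<c)
    0<i+d : 0 < i + d
    0<i+d = ℕ.<-≤-trans (ℕ.m<n⇒0<n∸m j<c) (ℕ.m≤n+m d i)
    i+d<c : i + d < c
    i+d<c = subst (i + d <_) j+d≡c (ℕ.+-monoˡ-< d i<j)
    shift : ∀ k → j + k ≤ j + d → g (i + k) ≡ g (j + k)
    shift zero    _ = subst₂ (λ a b → g a ≡ g b) (sym (ℕ.+-identityʳ i)) (sym (ℕ.+-identityʳ j)) gᵢ≡gⱼ
    shift (suc k) j+k<j+d rewrite ℕ.+-suc i k | ℕ.+-suc j k =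
      deterministic (ℕ.<-trans (ℕ.+-monoˡ-< k i<j) j+k<c) j+k<c (shift k (ℕ.<⇒≤ j+k<j+d))
      where
      j+k<c : j + k < c
      j+k<c = subst (j + k <_) j+d≡c j+k<j+d

closed-injective⇒moves : ∀ {A : Set} (g : ℕ → A) {c} → 1 < c → g c ≡ g 0 →
                         (∀ {i j} → i < c → j < c → g i ≡ g j → i ≡ j) → ∀ {t} → t < c → g (suc t) ≢ g t
closed-injective⇒moves g {c} 1<c closed injective {t} t<c stays with ℕ.m≤n⇒m<n∨m≡n t<c
... | inj₁ 1+t<c = ℕ.1+n≢n (injective 1+t<c t<c stays)
... | inj₂ refl = ℕ.<-irrefl (sym (cong suc t≡0)) 1<c
  where
  t≡0 : t ≡ 0
  t≡0 = injective t<c (ℕ.<-trans z<s 1<c) (trans (sym stays) closed)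

enumerate : ∀ {m} (P : Pred (Fin m) 0ℓ) → Decidable P → Irrelevant P → ∃[ k ] (Σ (Fin m) P ↔ Fin k)
enumerate {zero} P P? irr = 0 , mk↔ₛ′ (λ { (() , _) }) (λ ()) (λ ()) (λ { (() , _) })
enumerate {suc m} P P? irr with enumerate (P ∘ suc) (P? ∘ suc) irr | P? zero
... | k , ψ | yes p₀ = suc k , mk↔ₛ′ to from to∘from from∘to
  where
  module ψ = Inverse ψ
  to : Σ (Fin (suc m)) P → Fin (suc k)
  to (zero  , _) = zero
  to (suc i , p) = suc (ψ.to (i , p))
  from : Fin (suc k) → Σ (Fin (suc m)) P
  from zero    = zero , p₀
  from (suc x) = let (i , p) = ψ.from x in suc i , p
  to∘from : ∀ x → to (from x) ≡ x
  to∘from zero    = refl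
  to∘from (suc x) = cong suc (ψ.strictlyInverseˡ x)
  from∘to : ∀ y → from (to y) ≡ y
  from∘to (zero  , p) = cong (zero ,_) (irr p₀ p)
  from∘to (suc i , p) = cong (λ (j , q) → suc j , q) (ψ.strictlyInverseʳ (i , p))
... | k , ψ | no ¬p₀ = k , mk↔ₛ′ to from ψ.strictlyInverseˡ from∘to
  where
  module ψ = Inverse ψ
  to : Σ (Fin (suc m)) P → Fin k
  to (zero  , p) = contradiction p ¬p₀
  to (suc i , p) = ψ.to (i , p)
  from : Fin k → Σ (Fin (suc m)) P
  from x = let (i , p) = ψ.from x in suc i , p
  from∘to : ∀ y → from (to y) ≡ y
  from∘to (zero  , p) = contradiction p ¬p₀
  from∘to (suc i , p) = cong (λ (j , q) → suc j , q) (ψ.strictlyInverseʳ (i , p))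

module Fibres {m R : ℕ} (rep : Fin m → Fin R) where

  Fibre : Fin R → Set
  Fibre c = Σ (Fin m) λ e → rep e ≡ c

  private
    enumerate-fibre : ∀ c → ∃[ k ] (Fibre c ↔ Fin k)
    enumerate-fibre c = enumerate (λ e → rep e ≡ c) (λ e → rep e Fin.≟ c) (Decidable⇒UIP.≡-irrelevant Fin._≟_)

  size : Fin R → ℕ
  size c = proj₁ (enumerate-fibre c)

  fibre↔ : ∀ c → Fibre c ↔ Fin (size c)
  fibre↔ c = proj₂ (enumerate-fibre c)

  module fibre↔ c = Inverse (fibre↔ c)

  private
    split : Fin m → Σ (Fin R) (Fin ∘ size)
    split e = rep e , fibre↔.to (rep e) (e , refl)

    split-fibre : ∀ c (b : Fibre c) → split (proj₁ b) ≡ (c , fibre↔.to c b)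
    split-fibre _ (e , refl) = refl

  partition : Fin m ↔ Σ (Fin R) (Fin ∘ size)
  partition = mk↔ₛ′ split join split∘join join∘split
    where
    join : Σ (Fin R) (Fin ∘ size) → Fin m
    join (c , x) = proj₁ (fibre↔.from c x)
    split∘join : ∀ y → split (join y) ≡ y
    split∘join (c , x) = trans (split-fibre c (fibre↔.from c x)) (cong (c ,_) (fibre↔.strictlyInverseˡ c x))
    join∘split : ∀ e → join (split e) ≡ e
    join∘split e = cong proj₁ (fibre↔.strictlyInverseʳ (rep e) (e , refl))

  partition-fibre : ∀ c (b : Fibre c) → Inverse.to partition (proj₁ b) ≡ (c , fibre↔.to c b)
  partition-fibre = split-fibre

  fibre-≡ : ∀ {c} {b b′ : Fibre c} → proj₁ b ≡ proj₁ b′ → b ≡ b′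
  fibre-≡ refl = cong (_ ,_) (Decidable⇒UIP.≡-irrelevant Fin._≟_ _ _)

card≤n : ∀ {n} (Z : Fin n → Bool) → card Z ≤ n
card≤n {zero}  Z = z≤n
card≤n {suc n} Z with Z zero
... | true  = s≤s (card≤n (Z ∘ suc))
... | false = ℕ.m≤n⇒m≤1+n (card≤n (Z ∘ suc))

false⇒card<n : ∀ {n} (Z : Fin n → Bool) {i} → Z i ≡ false → card Z < n
false⇒card<n {suc n} Z {i} zᵢ with Z zero in z₀ | i
... | false | _     = s≤s (card≤n (Z ∘ suc))
... | true  | zero  = contradiction (trans (sym z₀) zᵢ) λ ()
... | true  | suc j = s≤s (false⇒card<n (Z ∘ suc) zᵢ)

card<n⇒false : ∀ {n} (Z : Fin n → Bool) → card Z < n → ∃[ i ] Z i ≡ false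
card<n⇒false {suc n} Z card<n with Z zero in z₀
... | false = zero , z₀
... | true  = let (i , zᵢ) = card<n⇒false (Z ∘ suc) (s≤s⁻¹ card<n) in suc i , zᵢ

card≤0⇒none : ∀ {n} (Z : Fin n → Bool) → card Z ≤ 0 → ∀ i → Z i ≡ false
card≤0⇒none {suc n} Z card≤0 i with Z zero in z₀ | i
... | false | zero  = z₀
... | false | suc j = card≤0⇒none (Z ∘ suc) card≤0 j

none⇒card≤0 : ∀ {n} (Z : Fin n → Bool) → (∀ i → Z i ≡ false) → card Z ≤ 0
none⇒card≤0 {zero}  Z all-false = z≤n
none⇒card≤0 {suc n} Z all-false with Z zero | all-false zero
... | false | refl = none⇒card≤0 (Z ∘ suc) (all-false ∘ suc)

card≤1⇒atMostOne : ∀ {n} (Z : Fin n → Bool) → card Z ≤ 1 →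
                   ∀ i j → Z i ≡ true → Z j ≡ true → i ≡ j
card≤1⇒atMostOne {suc n} Z card≤1 i j zᵢ zⱼ with Z zero in z₀ | i | j
... | _     | zero  | zero  = refl
... | true  | suc i | _     = contradiction (trans (sym zᵢ) (card≤0⇒none (Z ∘ suc) (s≤s⁻¹ card≤1) i)) λ ()
... | true  | zero  | suc j = contradiction (trans (sym zⱼ) (card≤0⇒none (Z ∘ suc) (s≤s⁻¹ card≤1) j)) λ ()
... | false | zero  | _     = contradiction (trans (sym zᵢ) z₀) λ ()
... | false | suc i | zero  = contradiction (trans (sym zⱼ) z₀) λ ()
... | false | suc i | suc j = cong suc (card≤1⇒atMostOne (Z ∘ suc) card≤1 i j zᵢ zⱼ)

atMostOne⇒card≤1 : ∀ {n} (Z : Fin n → Bool) → (∀ i j → Z i ≡ true → Z j ≡ true → i ≡ j) → card Z ≤ 1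
atMostOne⇒card≤1 {zero}  Z atMostOne = z≤n
atMostOne⇒card≤1 {suc n} Z atMostOne with Z zero in z₀
... | true  = s≤s (none⇒card≤0 (Z ∘ suc) rest-false)
  where
  rest-false : ∀ i → Z (suc i) ≡ false
  rest-false i with Z (suc i) in zᵢ
  ... | true  = contradiction (atMostOne zero (suc i) z₀ zᵢ) λ ()
  ... | false = refl
... | false = atMostOne⇒card≤1 (Z ∘ suc) λ i j zᵢ zⱼ → Fin.suc-injective (atMostOne (suc i) (suc j) zᵢ zⱼ)

data Rank : Set where
  none one allButOne : Rank

rank : Rank → ℕ → ℕ
rank none      n = 0
rank one       n = 1
rank allButOne n = n ∸ 1

Bounded : Rank → {B : Set} → (B → Bool) → Set
Bounded none          Z = ∀ b → Z b ≡ false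
Bounded one           Z = ∀ b b′ → Z b ≡ true → Z b′ ≡ true → b ≡ b′
Bounded allButOne {B} Z = B → ∃[ b ] Z b ≡ false

card≤rank⇔Bounded : ∀ ρ {n} (Z : Fin n → Bool) → card Z ≤ rank ρ n ⇔ Bounded ρ Z
card≤rank⇔Bounded none      Z = mk⇔ (card≤0⇒none Z) (none⇒card≤0 Z)
card≤rank⇔Bounded one       Z = mk⇔ (card≤1⇒atMostOne Z) (atMostOne⇒card≤1 Z)
card≤rank⇔Bounded allButOne {zero}  Z = mk⇔ (λ _ ()) (λ _ → z≤n)
card≤rank⇔Bounded allButOne {suc n} Z =
  mk⇔ (λ card≤n _ → card<n⇒false Z (s≤s card≤n))
      (λ some-false → s≤s⁻¹ (false⇒card<n Z (proj₂ (some-false zero))))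

Bounded-↔ : ∀ ρ {B C : Set} (ψ : B ↔ C) {Z′ : B → Bool} {Z : C → Bool} →
            (∀ b → Z′ b ≡ Z (Inverse.to ψ b)) → Bounded ρ Z′ ⇔ Bounded ρ Z
Bounded-↔ ρ ψ {Z′} {Z} pullback = mk⇔ (⇒ ρ) (⇐ ρ)
  where
  module ψ = Inverse ψ
  Z′∘from : ∀ c → Z′ (ψ.from c) ≡ Z c
  Z′∘from c = trans (pullback (ψ.from c)) (cong Z (ψ.strictlyInverseˡ c))
  ⇒ : ∀ ρ → Bounded ρ Z′ → Bounded ρ Z
  ⇒ none      all-false c = trans (sym (Z′∘from c)) (all-false (ψ.from c))
  ⇒ one       unique    c c′ z z′ = begin
    c                  ≡⟨ ψ.strictlyInverseˡ c ⟨
    ψ.to (ψ.from c)    ≡⟨ cong ψ.to (unique _ _ (trans (Z′∘from c) z) (trans (Z′∘from c′) z′)) ⟩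
    ψ.to (ψ.from c′)   ≡⟨ ψ.strictlyInverseˡ c′ ⟩
    c′                 ∎
  ⇒ allButOne some-false c = let (b , z) = some-false (ψ.from c) in ψ.to b , trans (sym (pullback b)) z
  ⇐ : ∀ ρ → Bounded ρ Z → Bounded ρ Z′
  ⇐ none      all-false b = trans (pullback b) (all-false (ψ.to b))
  ⇐ one       unique    b b′ z z′ = begin
    b                  ≡⟨ ψ.strictlyInverseʳ b ⟨
    ψ.from (ψ.to b)    ≡⟨ cong ψ.from (unique _ _ (trans (sym (pullback b)) z) (trans (sym (pullback b′)) z′)) ⟩
    ψ.from (ψ.to b′)   ≡⟨ ψ.strictlyInverseʳ b′ ⟩
    b′                 ∎
  ⇐ allButOne some-false b = let (c , z) = some-false (ψ.to b) in ψ.from c , trans (Z′∘from c) z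

module LinearForests (G : Digraph) where
  open Digraph G
  open Endo (Fin nV) using (_^_)
  module Path = SimplePath

  NonLoop : Fin nE → Set
  NonLoop e = src e ≢ tgt e

  EdgeIn : (Fin nE → Bool) → Fin nV → Fin nV → Set
  EdgeIn X u w = ∃[ e ] X e ≡ true × src e ≡ u × tgt e ≡ w

  Acyclic : (Fin nE → Bool) → Set
  Acyclic X = ∀ {q} (g : ℕ → Fin nV) → 0 < q → (∀ t → t < q → EdgeIn X (g t) (g (suc t))) → g q ≢ g 0

  acyclic⇒loop-free : ∀ {X} → Acyclic X → ∀ {e} → X e ≡ true → NonLoop e
  acyclic⇒loop-free acyclic {e} Xe src≡tgt =
    acyclic {1} (λ _ → src e) z<s (λ { zero _ → e , Xe , refl , sym src≡tgt ; (suc _) (s≤s ()) }) refl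

  record IsLinearForest (X : Fin nE → Bool) : Set where
    field
      src-injective : ∀ {e e′} → X e ≡ true → X e′ ≡ true → src e ≡ src e′ → e ≡ e′
      tgt-injective : ∀ {e e′} → X e ≡ true → X e′ ≡ true → tgt e ≡ tgt e′ → e ≡ e′
      acyclic       : Acyclic X

    loop-free : ∀ {e} → X e ≡ true → NonLoop e
    loop-free = acyclic⇒loop-free acyclic

  module _ {X : Fin nE → Bool} {r} (P : Fin r → SimplePath G)
           (disjoint : ∀ i j a b → Path.vert (P i) a ≡ Path.vert (P j) b → i ≡ j)
           (covers : ∀ e → X e ≡ true ⇔ (∃[ i ] ∃[ t ] Path.edge (P i) t ≡ e)) where

    private
      on-path : ∀ {e} → X e ≡ true → ∃[ i ] ∃[ t ] Path.edge (P i) t ≡ e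
      on-path = Equivalence.to (covers _)

      same-edge : ∀ {i j} {t : Fin (suc (Path.len (P i)))} {t′ : Fin (suc (Path.len (P j)))}
                  (f : ∀ {n} → Fin (suc n) → Fin (suc (suc n))) → (∀ {n} → Injective _≡_ _≡_ (f {n})) →
                  Path.vert (P i) (f t) ≡ Path.vert (P j) (f t′) → Path.edge (P i) t ≡ Path.edge (P j) t′
      same-edge {i} {j} f f-injective same-vertex with disjoint i j _ _ same-vertex
      ... | refl = cong (Path.edge (P i)) (f-injective (Path.distinct (P i) same-vertex))

      next-position : ∀ {i} a {e} → X e ≡ true → src e ≡ Path.vert (P i) a →
                      ∃[ a′ ] tgt e ≡ Path.vert (P i) a′ × toℕ a′ ≡ suc (toℕ a)
      next-position {i} a Xe src≡ with on-path Xe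
      ... | j , t , refl with disjoint j i _ _ (trans (sym (Path.edgeSrc (P j) t)) src≡)
      ... | refl = suc t , Path.edgeTgt (P i) t , cong suc (trans (sym (Fin.toℕ-inject₁ t)) (cong toℕ t≡a))
        where
        t≡a : inject₁ t ≡ a
        t≡a = Path.distinct (P i) (trans (sym (Path.edgeSrc (P i) t)) src≡)

    multipath-src-injective : ∀ {e e′} → X e ≡ true → X e′ ≡ true → src e ≡ src e′ → e ≡ e′
    multipath-src-injective Xe Xe′ src≡ with on-path Xe | on-path Xe′
    ... | i , t , refl | j , t′ , refl =
      same-edge inject₁ Fin.inject₁-injective (trans (sym (Path.edgeSrc (P i) t)) (trans src≡ (Path.edgeSrc (P j) t′)))

    multipath-tgt-injective : ∀ {e e′} → X e ≡ true → X e′ ≡ true → tgt e ≡ tgt e′ → e ≡ e′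
    multipath-tgt-injective Xe Xe′ tgt≡ with on-path Xe | on-path Xe′
    ... | i , t , refl | j , t′ , refl =
      same-edge suc Fin.suc-injective (trans (sym (Path.edgeTgt (P i) t)) (trans tgt≡ (Path.edgeTgt (P j) t′)))

    walk-along-path : ∀ {i} a₀ {n} (g : ℕ → Fin nV) → g 0 ≡ Path.vert (P i) a₀ →
                      (∀ t → t < n → EdgeIn X (g t) (g (suc t))) →
                      ∀ k → k ≤ n → ∃[ a ] g k ≡ Path.vert (P i) a × toℕ a ≡ k + toℕ a₀
    walk-along-path a₀ g g₀≡ steps zero    _       = a₀ , g₀≡ , refl
    walk-along-path a₀ g g₀≡ steps (suc k) 1+k≤n
      with walk-along-path a₀ g g₀≡ steps k (ℕ.<⇒≤ 1+k≤n) | steps k 1+k≤n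
    ... | a , gₖ≡ , a-position | e , Xe , srcₑ , tgtₑ with next-position a Xe (trans srcₑ gₖ≡)
    ... | a′ , tgt≡ , a′-position = a′ , trans (sym tgtₑ) tgt≡ , trans a′-position (cong suc a-position)

    -- Along an X-walk the position on the path of its first edge grows by one per step,
    -- so the walk cannot close up.
    multipath-acyclic : Acyclic X
    multipath-acyclic {suc q} g z<s steps closed with steps 0 z<s
    ... | e₀ , Xe₀ , src₀ , _ with on-path Xe₀
    ... | i , t₀ , refl with walk-along-path (inject₁ t₀) g g₀≡ steps (suc q) ℕ.≤-refl
      where
      g₀≡ : g 0 ≡ Path.vert (P i) (inject₁ t₀)
      g₀≡ = trans (sym src₀) (Path.edgeSrc (P i) t₀)
    ... | a , g≡ , a-position = ℕ.m≢1+n+m (toℕ (inject₁ t₀)) (trans (cong toℕ (sym a≡a₀)) a-position)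
      where
      a≡a₀ : a ≡ inject₁ t₀
      a≡a₀ = Path.distinct (P i) (trans (sym g≡) (trans closed (trans (sym src₀) (Path.edgeSrc (P i) t₀))))

  multipath⇒linearForest : ∀ {X} → IsMultipath G X → IsLinearForest X
  multipath⇒linearForest (_ , P , disjoint , covers) = record
    { src-injective = multipath-src-injective P disjoint covers
    ; tgt-injective = multipath-tgt-injective P disjoint covers
    ; acyclic       = multipath-acyclic P disjoint covers
    }

  module _ {X : Fin nE → Bool} (lf : IsLinearForest X) where
    open IsLinearForest lf

    HasOut HasIn : Fin nV → Set
    HasOut w = ∃[ e ] X e ≡ true × src e ≡ w
    HasIn  w = ∃[ e ] X e ≡ true × tgt e ≡ w

    hasOut? : Decidable HasOut
    hasOut? w = Fin.any? λ e → (X e Bool.≟ true) ×-dec (src e Fin.≟ w)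

    hasIn? : Decidable HasIn
    hasIn? w = Fin.any? λ e → (X e Bool.≟ true) ×-dec (tgt e Fin.≟ w)

    successor : Fin nV → Fin nV
    successor w with hasOut? w
    ... | yes (e , _) = tgt e
    ... | no _        = w

    successor-step : ∀ {w} → HasOut w → EdgeIn X w (successor w)
    successor-step {w} (e , Xe , srcₑ) with hasOut? w
    ... | yes (e′ , Xe′ , srcₑ′) = e′ , Xe′ , srcₑ′ , refl
    ... | no ¬out                = contradiction (e , Xe , srcₑ) ¬out

    predecessor : Fin nV → Fin nV
    predecessor w with hasIn? w
    ... | yes (e , _) = src e
    ... | no _        = w

    predecessor-step : ∀ {w} → HasIn w → EdgeIn X (predecessor w) w
    predecessor-step {w} (e , Xe , tgtₑ) with hasIn? w
    ... | yes (e′ , Xe′ , tgtₑ′) = e′ , Xe′ , refl , tgtₑ′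
    ... | no ¬in                 = contradiction (e , Xe , tgtₑ) ¬in

    forward backward : Fin nV → ℕ → Fin nV
    forward  s k = (successor ^ k) s
    backward s k = (predecessor ^ k) s

    walk-repeat-free : ∀ {n} (g : ℕ → Fin nV) → (∀ t → t < n → EdgeIn X (g t) (g (suc t))) →
                       ∀ {i j} → i < j → j ≤ n → g i ≢ g j
    walk-repeat-free g steps {i} {j} i<j j≤n gᵢ≡gⱼ =
      acyclic (λ t → g (i + t)) (ℕ.m<n⇒0<n∸m i<j) shifted-steps closed
      where
      shifted-steps : ∀ t → t < j ∸ i → EdgeIn X (g (i + t)) (g (i + suc t))
      shifted-steps t t<j∸i rewrite ℕ.+-suc i t =
        steps (i + t) (ℕ.<-≤-trans (subst (i + t <_) (ℕ.m+[n∸m]≡n (ℕ.<⇒≤ i<j)) (ℕ.+-monoʳ-< i t<j∸i)) j≤n)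
      closed : g (i + (j ∸ i)) ≡ g (i + 0)
      closed = trans (cong g (ℕ.m+[n∸m]≡n (ℕ.<⇒≤ i<j))) (trans (sym gᵢ≡gⱼ) (cong g (sym (ℕ.+-identityʳ i))))

    successor-tgt : ∀ {e w} → X e ≡ true → src e ≡ w → successor w ≡ tgt e
    successor-tgt Xe srcₑ with successor-step (_ , Xe , srcₑ)
    ... | e′ , Xe′ , srcₑ′ , tgtₑ′ =
      trans (sym tgtₑ′) (cong tgt (src-injective Xe′ Xe (trans srcₑ′ (sym srcₑ))))

    backward-repeat-free : ∀ {s n} → (∀ k → k < n → HasIn (backward s k)) →
                           ∀ {i j} → i < j → j ≤ n → backward s i ≢ backward s j
    backward-repeat-free {s} hasIn {i} {j} i<j j≤n bᵢ≡bⱼ =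
      walk-repeat-free (λ t → backward s (j ∸ t)) reversed-steps (ℕ.m<n⇒0<n∸m i<j) ℕ.≤-refl
        (trans (sym bᵢ≡bⱼ) (cong (backward s) (sym (ℕ.m∸[m∸n]≡n (ℕ.<⇒≤ i<j)))))
      where
      reversed-steps : ∀ t → t < j ∸ i → EdgeIn X (backward s (j ∸ t)) (backward s (j ∸ suc t))
      reversed-steps t t<j∸i = subst (λ k → EdgeIn X (backward s k) (backward s (j ∸ suc t)))
                                     (sym (ℕ.+-∸-assoc 1 t<j))
                                     (predecessor-step (hasIn (j ∸ suc t) (ℕ.<-≤-trans (ℕ.∸-monoʳ-< z<s t<j) j≤n)))
        where
        t<j : t < j
        t<j = ℕ.<-≤-trans t<j∸i (ℕ.m∸n≤m j i)

    record MaximalWalk (s : Fin nV) : Set where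
      field
        len   : ℕ
        alive : ∀ k → k ≤ len → HasOut (forward s k)
        stuck : ¬ HasOut (forward s (suc len))

    maximalWalk : ∀ {s} → HasOut s → MaximalWalk s
    maximalWalk {s} out with all⊎least-counterexample (hasOut? ∘ forward s) nV
    ... | inj₁ always with sequence-repeats (forward s)
    ...   | i , j , i<j , j≤nV , fᵢ≡fⱼ =
      contradiction fᵢ≡fⱼ
        (walk-repeat-free (forward s) (λ t t<nV → successor-step (always t (ℕ.<⇒≤ t<nV))) i<j j≤nV)
    maximalWalk out | inj₂ (zero  , _ , stuck₀ , _)      = contradiction out stuck₀
    maximalWalk out | inj₂ (suc m , _ , stuck , before) =
      record { len = m ; alive = λ k k≤m → before k (s≤s k≤m) ; stuck = stuck }

    maximalWalk-step : ∀ {s} (ρ : MaximalWalk s) (t : Fin (suc (MaximalWalk.len ρ))) →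
                       EdgeIn X (forward s (toℕ t)) (forward s (suc (toℕ t)))
    maximalWalk-step ρ t = successor-step (MaximalWalk.alive ρ (toℕ t) (s≤s⁻¹ (Fin.toℕ<n t)))

    walkPath : ∀ {s} → MaximalWalk s → SimplePath G
    walkPath {s} ρ = record
      { len      = len
      ; vert     = forward s ∘ toℕ
      ; edge     = proj₁ ∘ maximalWalk-step ρ
      ; distinct = λ {a} {b} →
          Fin.toℕ-injective ∘ repeat-free⇒injective (forward s) repeat-free (Fin.toℕ<n a) (Fin.toℕ<n b)
      ; edgeSrc  = λ t →
          trans (proj₁ (proj₂ (proj₂ (maximalWalk-step ρ t)))) (cong (forward s) (sym (Fin.toℕ-inject₁ t)))
      ; edgeTgt  = λ t → proj₂ (proj₂ (proj₂ (maximalWalk-step ρ t)))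
      }
      where
      open MaximalWalk ρ
      repeat-free : ∀ {i j} → i < j → j < suc (suc len) → forward s i ≢ forward s j
      repeat-free i<j j<2+len =
        walk-repeat-free (forward s) (λ t t≤len → successor-step (alive t (s≤s⁻¹ t≤len))) i<j (s≤s⁻¹ j<2+len)

    walkPath-covers : ∀ {s} (ρ : MaximalWalk s) {e k} → X e ≡ true → (∀ j → j ≤ k → HasOut (forward s j)) →
                     forward s k ≡ src e → ∃[ t ] Path.edge (walkPath ρ) t ≡ e
    walkPath-covers {s} ρ {e} {k} Xe out fₖ≡ with k ℕ.≤? MaximalWalk.len ρ
    ... | no k≰len  = contradiction (out (suc (MaximalWalk.len ρ)) (ℕ.≰⇒> k≰len)) (MaximalWalk.stuck ρ)
    ... | yes k≤len = t , src-injective (proj₁ (proj₂ (maximalWalk-step ρ t))) Xe src≡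
      where
      t : Fin (suc (MaximalWalk.len ρ))
      t = Fin.fromℕ< (s≤s k≤len)
      src≡ : src (Path.edge (walkPath ρ) t) ≡ src e
      src≡ = trans (Path.edgeSrc (walkPath ρ) t)
                   (trans (cong (forward s) (trans (Fin.toℕ-inject₁ t) (Fin.toℕ-fromℕ< (s≤s k≤len)))) fₖ≡)

    start-unique : ∀ {s s′} → ¬ HasIn s → ¬ HasIn s′ → ∀ a b →
                   (∀ k → k < a → HasOut (forward s k)) → (∀ k → k < b → HasOut (forward s′ k)) →
                   forward s a ≡ forward s′ b → s ≡ s′
    start-unique _   _    zero    zero    _   _    same = same
    start-unique ¬in _    zero    (suc b) _   out′ same =
      let (e , Xe , _ , tgtₑ) = successor-step (out′ b ℕ.≤-refl) in contradiction (e , Xe , trans tgtₑ (sym same)) ¬in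
    start-unique _   ¬in′ (suc a) zero    out _    same =
      let (e , Xe , _ , tgtₑ) = successor-step (out a ℕ.≤-refl) in contradiction (e , Xe , trans tgtₑ same) ¬in′
    start-unique ¬in ¬in′ (suc a) (suc b) out out′ same
      with successor-step (out a ℕ.≤-refl) | successor-step (out′ b ℕ.≤-refl)
    ... | e , Xe , srcₑ , tgtₑ | e′ , Xe′ , srcₑ′ , tgtₑ′ =
      start-unique ¬in ¬in′ a b (λ k → out k ∘ ℕ.m<n⇒m<1+n) (λ k → out′ k ∘ ℕ.m<n⇒m<1+n)
        (trans (sym srcₑ) (trans (cong src (tgt-injective Xe Xe′ (trans tgtₑ (trans same (sym tgtₑ′))))) srcₑ′))

    -- By acyclicity the backward walk from src e stops, at a start vertex whose forward walk
    -- retraces it.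
    start-of : ∀ {e} → X e ≡ true →
               ∃₂ λ s k → ¬ HasIn s × (∀ j → j ≤ k → HasOut (forward s j)) × forward s k ≡ src e
    start-of {e} Xe with all⊎least-counterexample (hasIn? ∘ backward (src e)) nV
    ... | inj₁ always with sequence-repeats (backward (src e))
    ...   | i , j , i<j , j≤nV , bᵢ≡bⱼ =
      contradiction bᵢ≡bⱼ (backward-repeat-free (λ k k<nV → always k (ℕ.<⇒≤ k<nV)) i<j j≤nV)
    start-of {e} Xe | inj₂ (k₀ , _ , ¬in , before) =
      b k₀ , k₀ , ¬in , forward-out , trans (forward-backward k₀ ℕ.≤-refl) (cong b (ℕ.n∸n≡0 k₀))
      where
      b = backward (src e)
      backward-out : ∀ k → k ≤ k₀ → HasOut (b k)
      backward-out zero    _ = e , Xe , refl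
      backward-out (suc k) 1+k≤k₀ =
        let (e′ , Xe′ , srcₑ′ , _) = predecessor-step (before k 1+k≤k₀) in e′ , Xe′ , srcₑ′
      forward-backward : ∀ j → j ≤ k₀ → forward (b k₀) j ≡ b (k₀ ∸ j)
      forward-backward zero    _      = refl
      forward-backward (suc j) 1+j≤k₀ with predecessor-step (before (k₀ ∸ suc j) (ℕ.∸-monoʳ-< z<s 1+j≤k₀))
      ... | e′ , Xe′ , srcₑ′ , tgtₑ′ = begin
        successor (forward (b k₀) j)  ≡⟨ cong successor (forward-backward j (ℕ.<⇒≤ 1+j≤k₀)) ⟩
        successor (b (k₀ ∸ j))        ≡⟨ successor-tgt Xe′ (trans srcₑ′ (cong b (sym k₀∸j≡1+k₀∸1+j))) ⟩
        tgt e′                        ≡⟨ tgtₑ′ ⟩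
        b (k₀ ∸ suc j)                ∎
        where
        k₀∸j≡1+k₀∸1+j : k₀ ∸ j ≡ suc (k₀ ∸ suc j)
        k₀∸j≡1+k₀∸1+j = ℕ.+-∸-assoc 1 1+j≤k₀
      forward-out : ∀ j → j ≤ k₀ → HasOut (forward (b k₀) j)
      forward-out j j≤k₀ = subst HasOut (sym (forward-backward j j≤k₀)) (backward-out (k₀ ∸ j) (ℕ.m∸n≤m k₀ j))

    IsStart : Fin nV → Set
    IsStart s = HasOut s × ¬ HasIn s

    isStart? : Decidable IsStart
    isStart? s = hasOut? s ×-dec ¬? (hasIn? s)

    linearForest⇒multipath : IsMultipath G X
    linearForest⇒multipath = r , P , disjoint , covers
      where
      Start : Fin nV → Set
      Start = True ∘ isStart?
      enumeration = enumerate Start (λ s → T? (isYes (isStart? s))) T-irrelevant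
      r = proj₁ enumeration
      module starts = Inverse (proj₂ enumeration)

      isStart : ((s , _) : Σ (Fin nV) Start) → IsStart s
      isStart (_ , start) = toWitness start

      walkFrom : ((s , _) : Σ (Fin nV) Start) → MaximalWalk s
      walkFrom y = maximalWalk (proj₁ (isStart y))

      P : Fin r → SimplePath G
      P = walkPath ∘ walkFrom ∘ starts.from

      out-before : ∀ y (a : Fin (suc (suc (MaximalWalk.len (walkFrom y))))) k → k < toℕ a → HasOut (forward (proj₁ y) k)
      out-before y a k k<a = MaximalWalk.alive (walkFrom y) k (s≤s⁻¹ (ℕ.<-≤-trans k<a (s≤s⁻¹ (Fin.toℕ<n a))))

      disjoint : ∀ i j a b → Path.vert (P i) a ≡ Path.vert (P j) b → i ≡ j
      disjoint i j a b same = begin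
        i                          ≡⟨ starts.strictlyInverseˡ i ⟨
        starts.to (starts.from i)  ≡⟨ cong starts.to (Σ-≡,≡→≡ (same-start , T-irrelevant _ _)) ⟩
        starts.to (starts.from j)  ≡⟨ starts.strictlyInverseˡ j ⟩
        j                          ∎
        where
        yᵢ = starts.from i
        yⱼ = starts.from j
        same-start = start-unique (proj₂ (isStart yᵢ)) (proj₂ (isStart yⱼ)) (toℕ a) (toℕ b)
                                  (out-before yᵢ a) (out-before yⱼ b) same

      covers : ∀ e → X e ≡ true ⇔ (∃[ i ] ∃[ t ] Path.edge (P i) t ≡ e)
      covers e = mk⇔ on-path in-X
        where
        on-path : X e ≡ true → ∃[ i ] ∃[ t ] Path.edge (P i) t ≡ e
        on-path Xe =
          let (s , k , ¬in , out , fₖ≡) = start-of Xe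
              y = s , fromWitness (out 0 z≤n , ¬in)
          in starts.to y , subst (λ y → ∃[ t ] Path.edge (walkPath (walkFrom y)) t ≡ e)
                                 (sym (starts.strictlyInverseʳ y)) (walkPath-covers (walkFrom y) Xe out fₖ≡)
        in-X : ∃[ i ] ∃[ t ] Path.edge (P i) t ≡ e → X e ≡ true
        in-X (i , t , refl) = proj₁ (proj₂ (maximalWalk-step (walkFrom (starts.from i)) t))

  multipath⇔linearForest : ∀ {X} → IsMultipath G X ⇔ IsLinearForest X
  multipath⇔linearForest = mk⇔ multipath⇒linearForest linearForest⇒multipath

module CycleSequences (G : Digraph) where
  open Digraph G
  open LinearForests G using (NonLoop; EdgeIn)

  record IsCycleSeq (g : ℕ → Fin nV) (len : ℕ) : Set where
    field
      injective : ∀ {i j} → i < 2 + len → j < 2 + len → g i ≡ g j → i ≡ j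
      step      : ∀ {t} → t < 2 + len → HasEdge G (g t) (g (suc t))
      closed    : g (2 + len) ≡ g 0

    cycle : Cycle G
    cycle = record
      { len      = len
      ; vert     = g ∘ toℕ
      ; distinct = λ {a} {b} → Fin.toℕ-injective ∘ injective (Fin.toℕ<n a) (Fin.toℕ<n b)
      ; step     = λ i → subst (λ k → HasEdge G (g k) (g (suc (toℕ i)))) (sym (Fin.toℕ-inject₁ i))
                                 (step (ℕ.m<n⇒m<1+n (Fin.toℕ<n i)))
      ; close    = subst (λ k → HasEdge G (g k) (g 0)) (sym (Fin.toℕ-fromℕ (suc len)))
                         (subst (HasEdge G (g (suc len))) closed (step ℕ.≤-refl))
      }

    moves : ∀ {t} → t < 2 + len → g (suc t) ≢ g t
    moves = closed-injective⇒moves g (s≤s (s≤s z≤n)) closed injective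

    vertex-index : ∀ {k} → k ≤ 2 + len → ∃[ a ] g k ≡ g (toℕ a)
    vertex-index k≤2+len with ℕ.m≤n⇒m<n∨m≡n k≤2+len
    ... | inj₁ k<2+len = fromℕ< k<2+len , cong g (sym (Fin.toℕ-fromℕ< k<2+len))
    ... | inj₂ refl    = zero , closed

    successor-injective : ∀ {k t} → k < 2 + len → t < 2 + len → g (suc k) ≡ g (suc t) → k ≡ t
    successor-injective k<2+len t<2+len same
      with ℕ.m≤n⇒m<n∨m≡n k<2+len | ℕ.m≤n⇒m<n∨m≡n t<2+len
    ... | inj₁ 1+k<2+len | inj₁ 1+t<2+len = ℕ.suc-injective (injective 1+k<2+len 1+t<2+len same)
    ... | inj₂ 1+k≡2+len | inj₂ 1+t≡2+len = ℕ.suc-injective (trans 1+k≡2+len (sym 1+t≡2+len))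
    ... | inj₁ 1+k<2+len | inj₂ refl = contradiction (injective 1+k<2+len z<s (trans same closed)) λ ()
    ... | inj₂ refl | inj₁ 1+t<2+len = contradiction (injective 1+t<2+len z<s (trans (sym same) closed)) λ ()

    module _ (component : IsComponent G cycle) where

      cycle-edge : ∀ e → (∃[ a ] src e ≡ g (toℕ a)) ⊎ (∃[ a ] tgt e ≡ g (toℕ a)) →
                   ∃[ k ] k < 2 + len × src e ≡ g k × tgt e ≡ g (suc k)
      cycle-edge e incident with component e incident
      ... | inj₁ (i , src≡ , tgt≡) =
        toℕ i , ℕ.m<n⇒m<1+n (Fin.toℕ<n i) , trans src≡ (cong g (Fin.toℕ-inject₁ i)) , tgt≡
      ... | inj₂ (src≡ , tgt≡) =
        suc len , ℕ.≤-refl , trans src≡ (cong g (Fin.toℕ-fromℕ (suc len))) , trans tgt≡ (sym closed)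

      out-of-cycle : ∀ e {t} → t < 2 + len → src e ≡ g t → tgt e ≡ g (suc t)
      out-of-cycle e t<2+len srcₑ with vertex-index (ℕ.<⇒≤ t<2+len)
      ... | a , gₜ≡ with cycle-edge e (inj₁ (a , trans srcₑ gₜ≡))
      ... | k , k<2+len , src≡ , tgt≡ rewrite injective k<2+len t<2+len (trans (sym src≡) srcₑ) = tgt≡

      into-cycle : ∀ e {t} → t < 2 + len → tgt e ≡ g (suc t) → src e ≡ g t
      into-cycle e t<2+len tgtₑ with vertex-index t<2+len
      ... | a , g₁₊ₜ≡ with cycle-edge e (inj₂ (a , trans tgtₑ g₁₊ₜ≡))
      ... | k , k<2+len , src≡ , tgt≡ rewrite successor-injective k<2+len t<2+len (trans (sym tgt≡) tgtₑ) = src≡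

  closedWalk⇒cycleSeq : ∀ {X} → (∀ {e} → X e ≡ true → NonLoop e) →
                        (∀ {e e′} → X e ≡ true → X e′ ≡ true → src e ≡ src e′ → e ≡ e′) →
                        ∀ {q} (g : ℕ → Fin nV) → 0 < q → (∀ t → t < q → EdgeIn X (g t) (g (suc t))) →
                        g q ≡ g 0 →
                        ∃[ len ] IsCycleSeq g len × (∀ t → t < 2 + len → EdgeIn X (g t) (g (suc t)))
  closedWalk⇒cycleSeq {X} loop-free src-injective g 0<q steps closed with first-return g 0<q closed
  ... | suc (suc len) , _ , c≤q , returns , first =
    len , record { injective = injective ; step = HasEdge∘step ; closed = returns } , steps-below
    where
    steps-below : ∀ t → t < 2 + len → EdgeIn X (g t) (g (suc t))
    steps-below t t<c = steps t (ℕ.<-≤-trans t<c c≤q)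
    deterministic : ∀ {a b} → a < 2 + len → b < 2 + len → g a ≡ g b → g (suc a) ≡ g (suc b)
    deterministic a<c b<c same with steps-below _ a<c | steps-below _ b<c
    ... | e , Xe , srcₑ , tgtₑ | e′ , Xe′ , srcₑ′ , tgtₑ′ =
      trans (sym tgtₑ) (trans (cong tgt (src-injective Xe Xe′ (trans srcₑ (trans same (sym srcₑ′))))) tgtₑ′)
    injective = first-return-injective g returns first deterministic
    HasEdge∘step : ∀ {t} → t < 2 + len → HasEdge G (g t) (g (suc t))
    HasEdge∘step t<c = let (e , _ , srcₑ , tgtₑ) = steps-below _ t<c in e , srcₑ , tgtₑ
  ... | suc zero , _ , _ , returns , _ with steps 0 0<q
  ...   | e , Xe , srcₑ , tgtₑ = contradiction (trans srcₑ (trans (sym returns) (sym tgtₑ))) (loop-free Xe)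

module SharedEndpoints (G : Digraph) where
  open Digraph G
  open LinearForests G using (NonLoop)

  ShareEndpoint : Fin nE → Fin nE → Set
  ShareEndpoint e e′ = src e ≡ src e′ ⊎ tgt e ≡ tgt e′

  ShareEndpoint-sym : ∀ {e e′} → ShareEndpoint e e′ → ShareEndpoint e′ e
  ShareEndpoint-sym (inj₁ src≡) = inj₁ (sym src≡)
  ShareEndpoint-sym (inj₂ tgt≡) = inj₂ (sym tgt≡)

  module _ (no-DA : ¬ ContainsDA G) (no-DB : ¬ ContainsDB G) where

    -- Otherwise e₁, e₂, e₃ would form D_A (if src e₃ = tgt e₁) or D_B.
    share-zigzag : ∀ {e₁ e₂ e₃} → NonLoop e₁ → NonLoop e₂ → NonLoop e₃ →
                   src e₁ ≡ src e₂ → tgt e₂ ≡ tgt e₃ → ShareEndpoint e₁ e₃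
    share-zigzag {e₁} {e₂} {e₃} nl₁ nl₂ nl₃ src₁₂ tgt₂₃
      with tgt e₁ Fin.≟ tgt e₂ | src e₃ Fin.≟ src e₂
    ... | yes tgt₁₂ | _         = inj₂ (trans tgt₁₂ tgt₂₃)
    ... | no _      | yes src₃₂ = inj₁ (trans src₁₂ (sym src₃₂))
    ... | no tgt₁≢₂ | no src₃≢₂ with src e₃ Fin.≟ tgt e₁
    ...   | yes src₃≡tgt₁ = contradiction DA no-DA
      where
      DA : ContainsDA G
      DA = lookup (tgt e₁ ∷ src e₁ ∷ tgt e₂ ∷ [])
         , (λ {i} {j} → lookup-injective distinct i j)
         , (e₁ , refl , refl) , (e₃ , src₃≡tgt₁ , sym tgt₂₃) , (e₂ , sym src₁₂ , refl)
        where
        distinct = ((nl₁ ∘ sym) ∷ tgt₁≢₂ ∷ [])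
                 ∷ ((λ eq → nl₂ (trans (sym src₁₂) eq)) ∷ [])
                 ∷ [] ∷ []
    ...   | no src₃≢tgt₁ = contradiction DB no-DB
      where
      DB : ContainsDB G
      DB = lookup (src e₃ ∷ tgt e₂ ∷ src e₂ ∷ tgt e₁ ∷ [])
         , (λ {i} {j} → lookup-injective distinct i j)
         , (e₃ , refl , sym tgt₂₃) , (e₂ , refl , refl) , (e₁ , src₁₂ , refl)
        where
        distinct = ((λ eq → nl₃ (trans eq tgt₂₃)) ∷ src₃≢₂ ∷ src₃≢tgt₁ ∷ [])
                 ∷ ((nl₂ ∘ sym) ∷ (tgt₁≢₂ ∘ sym) ∷ [])
                 ∷ ((λ eq → nl₁ (trans src₁₂ eq)) ∷ [])
                 ∷ [] ∷ []

    ShareEndpoint-trans : ∀ {e₁ e₂ e₃} → NonLoop e₁ → NonLoop e₂ → NonLoop e₃ →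
                          ShareEndpoint e₁ e₂ → ShareEndpoint e₂ e₃ → ShareEndpoint e₁ e₃
    ShareEndpoint-trans _   _   _   (inj₁ src₁₂) (inj₁ src₂₃) = inj₁ (trans src₁₂ src₂₃)
    ShareEndpoint-trans _   _   _   (inj₂ tgt₁₂) (inj₂ tgt₂₃) = inj₂ (trans tgt₁₂ tgt₂₃)
    ShareEndpoint-trans nl₁ nl₂ nl₃ (inj₁ src₁₂) (inj₂ tgt₂₃) = share-zigzag nl₁ nl₂ nl₃ src₁₂ tgt₂₃
    ShareEndpoint-trans nl₁ nl₂ nl₃ (inj₂ tgt₁₂) (inj₁ src₂₃) =
      ShareEndpoint-sym (share-zigzag nl₃ nl₂ nl₁ (sym src₂₃) (sym tgt₁₂))

module CanonicalSuccessor (G : Digraph) where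
  open Digraph G
  open Endo (Fin nV) using (_^_; ^-homo)
  open LinearForests G using (NonLoop; EdgeIn)
  open CycleSequences G

  nonLoop? : Decidable NonLoop
  nonLoop? e = ¬? (src e Fin.≟ tgt e)

  nonLoopOut? : ∀ v → Dec (∃[ e ] src e ≡ v × NonLoop e)
  nonLoopOut? v = Fin.any? λ e → (src e Fin.≟ v) ×-dec nonLoop? e

  -- By MP2 a cycle is a component, so on a cycle `next` is the successor along the cycle.
  next : Fin nV → Fin nV
  next v with nonLoopOut? v
  ... | yes (e , _) = tgt e
  ... | no _        = v

  next-step : ∀ {v} → next v ≢ v → HasEdge G v (next v)
  next-step {v} moves with nonLoopOut? v
  ... | yes (e , srcₑ , _) = e , srcₑ , refl
  ... | no _               = contradiction refl moves

  next-moves : ∀ {e v} → src e ≡ v → NonLoop e → next v ≢ v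
  next-moves {e} {v} srcₑ nonLoop with nonLoopOut? v
  ... | yes (e′ , srcₑ′ , nonLoop′) = λ stays → nonLoop′ (trans srcₑ′ (sym stays))
  ... | no no-out                   = contradiction (e , srcₑ , nonLoop) no-out

  next^-+ : ∀ m n v → (next ^ (m + n)) v ≡ (next ^ m) ((next ^ n) v)
  next^-+ m n v = cong-app (^-homo next m n) v

  orbit-reduce : ∀ {v q} → 0 < q → (next ^ q) v ≡ v → ∀ k → ∃[ j ] j < q × (next ^ k) v ≡ (next ^ j) v
  orbit-reduce 0<q returns zero = 0 , 0<q , refl
  orbit-reduce {v} 0<q returns (suc k) with orbit-reduce 0<q returns k
  ... | j , j<q , same with ℕ.m≤n⇒m<n∨m≡n j<q
  ...   | inj₁ 1+j<q = suc j , 1+j<q , cong next same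
  ...   | inj₂ 1+j≡q = 0 , 0<q , trans (cong next same) (trans (cong (λ n → (next ^ n) v) 1+j≡q) returns)

  OnCycle : Fin nV → Set
  OnCycle v = next v ≢ v × ∃[ p ] (next ^ suc (toℕ {nV} p)) v ≡ v

  onCycle? : Decidable OnCycle
  onCycle? v = ¬? (next v Fin.≟ v) ×-dec Fin.any? λ p → (next ^ suc (toℕ p)) v Fin.≟ v

  onCycle⇒cycleSeq : ∀ {v} → OnCycle v → ∃[ len ] IsCycleSeq (λ k → (next ^ k) v) len
  onCycle⇒cycleSeq {v} (moves , p , returns) with first-return (λ k → (next ^ k) v) {suc (toℕ p)} z<s returns
  ... | suc zero       , _ , _ , returns₁ , _     = contradiction returns₁ moves
  ... | suc (suc len) , _ , _ , returnsₗ , first =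
    len , record
      { injective = injective
      ; step      = next-step ∘ closed-injective⇒moves _ (s≤s (s≤s z≤n)) returnsₗ injective
      ; closed    = returnsₗ
      }
    where
    injective = first-return-injective (λ k → (next ^ k) v) returnsₗ first (λ _ _ → cong next)

  orbit-onCycle : ∀ {v} → OnCycle v → ∀ k → OnCycle ((next ^ k) v)
  orbit-onCycle {v} cyc@(_ , p , returns) k =
    subst (λ w → next w ≢ w) (sym same) (IsCycleSeq.moves C j<c) , p , returnsₖ
    where
    C = proj₂ (onCycle⇒cycleSeq cyc)
    reduced = orbit-reduce {v} z<s (IsCycleSeq.closed C) k
    j<c = proj₁ (proj₂ reduced)
    same = proj₂ (proj₂ reduced)
    returnsₖ : (next ^ suc (toℕ p)) ((next ^ k) v) ≡ (next ^ k) v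
    returnsₖ = begin
      (next ^ suc (toℕ p)) ((next ^ k) v)  ≡⟨ next^-+ (suc (toℕ p)) k v ⟨
      (next ^ (suc (toℕ p) + k)) v         ≡⟨ cong (λ n → (next ^ n) v) (ℕ.+-comm (suc (toℕ p)) k) ⟩
      (next ^ (k + suc (toℕ p))) v         ≡⟨ next^-+ k (suc (toℕ p)) v ⟩
      (next ^ k) ((next ^ suc (toℕ p)) v)  ≡⟨ cong (next ^ k) returns ⟩
      (next ^ k) v                         ∎

  orbit-edge : ∀ {v} → OnCycle v → ∀ t → ∃[ e ] src e ≡ (next ^ t) v × tgt e ≡ (next ^ suc t) v
  orbit-edge cyc t = next-step (proj₁ (orbit-onCycle cyc t))

  -- The bound nV (≥ any period) keeps SameCycle decidable.
  SameCycle : Fin nE → Fin nE → Set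
  SameCycle e e′ = ∃[ j ] (next ^ toℕ {suc nV} j) (src e) ≡ src e′

  sameCycle : ∀ {e e′} k → k ≤ nV → (next ^ k) (src e) ≡ src e′ → SameCycle e e′
  sameCycle {e} k k≤nV reach =
    fromℕ< (s≤s k≤nV) , trans (cong (λ n → (next ^ n) (src e)) (Fin.toℕ-fromℕ< (s≤s k≤nV))) reach

  SameCycle-sym : ∀ {e e′} → OnCycle (src e) → SameCycle e e′ → SameCycle e′ e
  SameCycle-sym {e} {e′} (_ , p , returns) (j , reach) with orbit-reduce z<s returns (toℕ j)
  ... | j′ , j′<q , same = sameCycle (q ∸ j′) (ℕ.≤-trans (ℕ.m∸n≤m q j′) (Fin.toℕ<n p)) back
    where
    q = suc (toℕ p)
    back : (next ^ (q ∸ j′)) (src e′) ≡ src e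
    back = begin
      (next ^ (q ∸ j′)) (src e′)               ≡⟨ cong (next ^ (q ∸ j′)) (trans (sym reach) same) ⟩
      (next ^ (q ∸ j′)) ((next ^ j′) (src e))  ≡⟨ next^-+ (q ∸ j′) j′ (src e) ⟨
      (next ^ (q ∸ j′ + j′)) (src e)           ≡⟨ cong (λ n → (next ^ n) (src e)) (ℕ.m∸n+n≡m (ℕ.<⇒≤ j′<q)) ⟩
      (next ^ q) (src e)                       ≡⟨ returns ⟩
      src e                                    ∎

  SameCycle-trans : ∀ {e₁ e₂ e₃} → OnCycle (src e₁) →
                    SameCycle e₁ e₂ → SameCycle e₂ e₃ → SameCycle e₁ e₃
  SameCycle-trans {e₁} {e₂} {e₃} (_ , p , returns) (j₁ , reach₁) (j₂ , reach₂)
    with orbit-reduce z<s returns (toℕ j₂ + toℕ j₁)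
  ... | j , j<q , same = sameCycle j (ℕ.≤-trans (s≤s⁻¹ j<q) (ℕ.<⇒≤ (Fin.toℕ<n p))) (begin
    (next ^ j) (src e₁)                        ≡⟨ same ⟨
    (next ^ (toℕ j₂ + toℕ j₁)) (src e₁)        ≡⟨ next^-+ (toℕ j₂) (toℕ j₁) (src e₁) ⟩
    (next ^ toℕ j₂) ((next ^ toℕ j₁) (src e₁)) ≡⟨ cong (next ^ toℕ j₂) reach₁ ⟩
    (next ^ toℕ j₂) (src e₂)                   ≡⟨ reach₂ ⟩
    src e₃                                     ∎)

  module CyclesAreComponents (mp2 : MP2 G) where

    module _ {v} (cyc : OnCycle v) where
      private
        C = proj₂ (onCycle⇒cycleSeq cyc)

      onCycle-out : ∀ e → src e ≡ v → tgt e ≡ next v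
      onCycle-out e = IsCycleSeq.out-of-cycle C (mp2 (IsCycleSeq.cycle C)) e z<s

      onCycle-in : ∀ e → tgt e ≡ next v → src e ≡ v
      onCycle-in e = IsCycleSeq.into-cycle C (mp2 (IsCycleSeq.cycle C)) e z<s

    onCycle-src-unique : ∀ {e e′} → OnCycle (src e) → NonLoop e → src e′ ≡ src e → e′ ≡ e
    onCycle-src-unique {e} {e′} cyc nonLoop src≡ =
      sym (atMostOne e e′ nonLoop (sym src≡) (trans (onCycle-out cyc e refl) (sym (onCycle-out cyc e′ src≡))))

    onCycle-tgt-unique : ∀ {e e′} → OnCycle (src e) → NonLoop e → tgt e′ ≡ tgt e → e′ ≡ e
    onCycle-tgt-unique {e} {e′} cyc nonLoop tgt≡ =
      sym (atMostOne e e′ nonLoop (sym src≡) (sym tgt≡))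
      where
      src≡ : src e′ ≡ src e
      src≡ = onCycle-in cyc e′ (trans tgt≡ (onCycle-out cyc e refl))

    module _ {g len} (C : IsCycleSeq g len) where
      open IsCycleSeq C

      private
        component : IsComponent G cycle
        component = mp2 cycle

      cycleSeq-next : ∀ {t} → t < 2 + len → next (g t) ≡ g (suc t)
      cycleSeq-next t<2+len =
        let (e , srcₑ , tgtₑ) = step t<2+len
            nonLoop src≡tgt = moves t<2+len (trans (sym tgtₑ) (trans (sym src≡tgt) srcₑ))
            (e′ , srcₑ′ , tgtₑ′) = next-step (next-moves srcₑ nonLoop)
        in trans (sym tgtₑ′) (out-of-cycle component e′ t<2+len srcₑ′)

      cycleSeq-orbit : ∀ k → k ≤ 2 + len → (next ^ k) (g 0) ≡ g k
      cycleSeq-orbit zero    _        = refl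
      cycleSeq-orbit (suc k) 1+k≤2+len =
        trans (cong next (cycleSeq-orbit k (ℕ.<⇒≤ 1+k≤2+len))) (cycleSeq-next 1+k≤2+len)

      cycleSeq-reach : ∀ k → ∃[ t ] t < 2 + len × (next ^ k) (g 0) ≡ g t
      cycleSeq-reach k with orbit-reduce z<s (trans (cycleSeq-orbit (2 + len) ℕ.≤-refl) closed) k
      ... | t , t<2+len , same = t , t<2+len , trans same (cycleSeq-orbit t (ℕ.<⇒≤ t<2+len))

      cycleSeq-onCycle : OnCycle (g 0)
      cycleSeq-onCycle = (λ stays → moves z<s (trans (sym (cycleSeq-next z<s)) stays)) , p , returns
        where
        2+len≤nV : 2 + len ≤ nV
        2+len≤nV = Fin.injective⇒≤ (Cycle.distinct cycle)
        p : Fin nV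
        p = fromℕ< 2+len≤nV
        returns : (next ^ suc (toℕ p)) (g 0) ≡ g 0
        returns = trans (cong (λ n → (next ^ suc n) (g 0)) (Fin.toℕ-fromℕ< 2+len≤nV))
                        (trans (cycleSeq-orbit (2 + len) ℕ.≤-refl) closed)

      cycleSeq-edge : ∀ {X} → (∀ t → t < 2 + len → EdgeIn X (g t) (g (suc t))) →
                      ∀ {e t} → t < 2 + len → src e ≡ g t → X e ≡ true
      cycleSeq-edge {X} X-steps {e} t<2+len srcₑ with X-steps _ t<2+len
      ... | eₜ , Xeₜ , srcₜ , tgtₜ = subst (λ e → X e ≡ true) eₜ≡e Xeₜ
        where
        eₜ≡e : eₜ ≡ e
        eₜ≡e = atMostOne eₜ e (λ src≡tgt → moves t<2+len (trans (sym tgtₜ) (trans (sym src≡tgt) srcₜ)))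
                         (trans srcₜ (sym srcₑ)) (trans tgtₜ (sym (out-of-cycle component e t<2+len srcₑ)))


module EdgeClasses (G : Digraph) (mp : IsMPDigraph G) where
  open Digraph G
  open Endo (Fin nV) using (_^_)
  open LinearForests G
  open CycleSequences G
  open SharedEndpoints G
  open CanonicalSuccessor G
  open CyclesAreComponents (proj₂ mp)

  Cyclic OffCycle : Fin nE → Set
  Cyclic   e = NonLoop e × OnCycle (src e)
  OffCycle e = NonLoop e × ¬ OnCycle (src e)

  infix 4 _∼_
  _∼_ : Fin nE → Fin nE → Set
  e ∼ e′ = e ≡ e′
         ⊎ (OffCycle e × OffCycle e′ × ShareEndpoint e e′)
         ⊎ (Cyclic e × Cyclic e′ × SameCycle e e′)

  cyclic? : Decidable Cyclic
  cyclic? e = nonLoop? e ×-dec onCycle? (src e)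

  offCycle? : Decidable OffCycle
  offCycle? e = nonLoop? e ×-dec ¬? (onCycle? (src e))

  _∼?_ : ∀ e e′ → Dec (e ∼ e′)
  e ∼? e′ = (e Fin.≟ e′)
    ⊎-dec (offCycle? e ×-dec offCycle? e′ ×-dec ((src e Fin.≟ src e′) ⊎-dec (tgt e Fin.≟ tgt e′)))
    ⊎-dec (cyclic? e ×-dec cyclic? e′ ×-dec Fin.any? λ j → (next ^ toℕ j) (src e) Fin.≟ src e′)

  ∼-sym : ∀ {e e′} → e ∼ e′ → e′ ∼ e
  ∼-sym (inj₁ refl)                           = inj₁ refl
  ∼-sym (inj₂ (inj₁ (off , off′ , share)))    = inj₂ (inj₁ (off′ , off , ShareEndpoint-sym share))
  ∼-sym (inj₂ (inj₂ (cyc , cyc′ , same)))     = inj₂ (inj₂ (cyc′ , cyc , SameCycle-sym (proj₂ cyc) same))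

  ∼-trans : ∀ {e₁ e₂ e₃} → e₁ ∼ e₂ → e₂ ∼ e₃ → e₁ ∼ e₃
  ∼-trans (inj₁ refl) r₂₃ = r₂₃
  ∼-trans r₁₂ (inj₁ refl) = r₁₂
  ∼-trans (inj₂ (inj₁ (off₁ , off₂ , share₁₂))) (inj₂ (inj₁ (_ , off₃ , share₂₃))) =
    inj₂ (inj₁ (off₁ , off₃ , ShareEndpoint-trans no-DA no-DB (proj₁ off₁) (proj₁ off₂) (proj₁ off₃)
                                                  share₁₂ share₂₃))
    where
    no-DA = proj₁ (proj₁ mp)
    no-DB = proj₁ (proj₂ (proj₂ (proj₁ mp)))
  ∼-trans (inj₂ (inj₁ (_ , off₂ , _))) (inj₂ (inj₂ (cyc₂ , _ , _))) =
    contradiction (proj₂ cyc₂) (proj₂ off₂)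
  ∼-trans (inj₂ (inj₂ (_ , cyc₂ , _))) (inj₂ (inj₁ (off₂ , _ , _))) =
    contradiction (proj₂ cyc₂) (proj₂ off₂)
  ∼-trans (inj₂ (inj₂ (cyc₁ , _ , same₁₂))) (inj₂ (inj₂ (_ , cyc₃ , same₂₃))) =
    inj₂ (inj₂ (cyc₁ , cyc₃ , SameCycle-trans (proj₂ cyc₁) same₁₂ same₂₃))

  ∼-loop : ∀ {e c} → ¬ NonLoop c → e ∼ c → e ≡ c
  ∼-loop _    (inj₁ e≡c)                   = e≡c
  ∼-loop loop (inj₂ (inj₁ (_ , off , _))) = contradiction (proj₁ off) loop
  ∼-loop loop (inj₂ (inj₂ (_ , cyc , _))) = contradiction (proj₁ cyc) loop

  ∼-NonLoop : ∀ {e e′} → e ∼ e′ → NonLoop e′ → NonLoop e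
  ∼-NonLoop (inj₁ refl)                  nonLoop = nonLoop
  ∼-NonLoop (inj₂ (inj₁ (off , _ , _))) _       = proj₁ off
  ∼-NonLoop (inj₂ (inj₂ (cyc , _ , _))) _       = proj₁ cyc

  ∼-Cyclic : ∀ {e e′} → e ∼ e′ → Cyclic e → Cyclic e′
  ∼-Cyclic (inj₁ refl)                   cyc = cyc
  ∼-Cyclic (inj₂ (inj₁ (off , _ , _)))  cyc = contradiction (proj₂ cyc) (proj₂ off)
  ∼-Cyclic (inj₂ (inj₂ (_ , cyc′ , _))) _   = cyc′

  ∼-OffCycle : ∀ {e e′} → e ∼ e′ → OffCycle e → OffCycle e′
  ∼-OffCycle (inj₁ refl)                   off = off
  ∼-OffCycle (inj₂ (inj₁ (_ , off′ , _))) _   = off′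
  ∼-OffCycle (inj₂ (inj₂ (cyc , _ , _)))  off = contradiction (proj₂ cyc) (proj₂ off)

  rep : Fin nE → Fin nE
  rep e = proj₁ (least-witness (e ∼?_) e (inj₁ refl))

  ∼rep : ∀ e → e ∼ rep e
  ∼rep e = proj₁ (proj₂ (least-witness (e ∼?_) e (inj₁ refl)))

  rep-least : ∀ {e e′} → e ∼ e′ → rep e Fin.≤ e′
  rep-least {e} = proj₂ (proj₂ (least-witness (e ∼?_) e (inj₁ refl))) _

  ∼⇒rep≡ : ∀ {e e′} → e ∼ e′ → rep e ≡ rep e′
  ∼⇒rep≡ {e} {e′} e∼e′ =
    Fin.≤-antisym (rep-least (∼-trans e∼e′ (∼rep e′))) (rep-least (∼-trans (∼-sym e∼e′) (∼rep e)))

  rep≡⇒∼ : ∀ {e e′} → rep e ≡ rep e′ → e ∼ e′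
  rep≡⇒∼ {e} {e′} same-class = ∼-trans (∼rep e) (subst (_∼ e′) (sym same-class) (∼-sym (∼rep e′)))

  data Kind (c : Fin nE) : Set where
    loop     : ¬ NonLoop c → Kind c
    cyclic   : Cyclic c → Kind c
    offCycle : OffCycle c → Kind c

  kind : ∀ c → Kind c
  kind c with nonLoop? c | onCycle? (src c)
  ... | no loop′     | _         = loop loop′
  ... | yes nonLoop | yes cyc   = cyclic (nonLoop , cyc)
  ... | yes nonLoop | no ¬cyc   = offCycle (nonLoop , ¬cyc)

  kindRank : ∀ {c} → Kind c → Rank
  kindRank (loop _)     = none
  kindRank (cyclic _)   = allButOne
  kindRank (offCycle _) = one

  -- Classes are indexed by all edges: a non-representative c indexes the empty class Fibre c.
  open Fibres rep public using (Fibre; size; partition; partition-fibre; fibre↔; fibre-≡)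

  ClassBounded : (Fin nE → Bool) → ∀ c → Kind c → Set
  ClassBounded X c k = Bounded (kindRank k) (λ (b : Fibre c) → X (proj₁ b))

  RespectsClasses : (Fin nE → Bool) → Set
  RespectsClasses X = ∀ c → ClassBounded X c (kind c)

  in-class : ∀ {e c} → rep e ≡ c → e ∼ c
  in-class {e} e∈c = subst (e ∼_) e∈c (∼rep e)

  orbit-edge-∼ : ∀ {c} (cyc : Cyclic c) t → t ≤ nV → c ∼ proj₁ (orbit-edge (proj₂ cyc) t)
  orbit-edge-∼ {c} cyc t t≤nV = inj₂ (inj₂ (cyc , (nonLoop , subst OnCycle (sym srcₑ) cycₜ) , sameCycle t t≤nV (sym srcₑ)))
    where
    cycₜ : OnCycle ((next ^ t) (src c))
    cycₜ = orbit-onCycle (proj₂ cyc) t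
    srcₑ : src (proj₁ (orbit-edge (proj₂ cyc) t)) ≡ (next ^ t) (src c)
    srcₑ = proj₁ (proj₂ (orbit-edge (proj₂ cyc) t))
    nonLoop : NonLoop (proj₁ (orbit-edge (proj₂ cyc) t))
    nonLoop src≡tgt = proj₁ cycₜ (trans (sym (proj₂ (proj₂ (orbit-edge (proj₂ cyc) t)))) (trans (sym src≡tgt) srcₑ))

  cycleSeq-class : ∀ {g len} (C : IsCycleSeq g len) {e₀ e} → src e₀ ≡ g 0 → Cyclic e₀ → e₀ ∼ e →
                   ∃[ t ] t < 2 + len × src e ≡ g t
  cycleSeq-class C src₀ _   (inj₁ refl)                       = 0 , z<s , src₀
  cycleSeq-class C _    cyc (inj₂ (inj₁ (off , _ , _)))      = contradiction (proj₂ cyc) (proj₂ off)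
  cycleSeq-class C src₀ _   (inj₂ (inj₂ (_ , _ , j , reach))) =
    let (t , t<2+len , same) = cycleSeq-reach C (toℕ j)
    in t , t<2+len , trans (sym reach) (trans (cong (next ^ toℕ j) src₀) same)

  module _ {X : Fin nE → Bool} (lf : IsLinearForest X) where
    open IsLinearForest lf

    offCycle-class-unique : ∀ {c} → OffCycle c → ∀ {e e′} → e ∼ c → e ∼ e′ →
                            X e ≡ true → X e′ ≡ true → e ≡ e′
    offCycle-class-unique _   _   (inj₁ e≡e′)                        _  _   = e≡e′
    offCycle-class-unique _   _   (inj₂ (inj₁ (_ , _ , inj₁ src≡))) Xe Xe′ = src-injective Xe Xe′ src≡
    offCycle-class-unique _   _   (inj₂ (inj₁ (_ , _ , inj₂ tgt≡))) Xe Xe′ = tgt-injective Xe Xe′ tgt≡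
    offCycle-class-unique off e∼c (inj₂ (inj₂ (cyc , _ , _)))        _  _   =
      contradiction (proj₂ (∼-Cyclic e∼c cyc)) (proj₂ off)

    cyclic-class-incomplete : ∀ {c} → Cyclic c → ∃[ e ] c ∼ e × X e ≡ false
    cyclic-class-incomplete {c} cyc@(_ , cycᵥ@(_ , p , returns)) =
      search (Fin.any? λ t → X (edgeₜ (toℕ t)) Bool.≟ false)
      where
      q = suc (toℕ p)
      edgeₜ : ℕ → Fin nE
      edgeₜ t = proj₁ (orbit-edge cycᵥ t)
      search : Dec (∃[ t ] X (edgeₜ (toℕ {q} t)) ≡ false) → ∃[ e ] c ∼ e × X e ≡ false
      search (yes (t , Xf)) =
        edgeₜ (toℕ t) , orbit-edge-∼ cyc (toℕ t) (ℕ.≤-trans (s≤s⁻¹ (Fin.toℕ<n t)) (ℕ.<⇒≤ (Fin.toℕ<n p))) , Xf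
      search (no none-missing) = contradiction returns (acyclic (λ k → (next ^ k) (src c)) z<s steps)
        where
        steps : ∀ t → t < q → EdgeIn X ((next ^ t) (src c)) ((next ^ suc t) (src c))
        steps t t<q = let (e , srcₑ , tgtₑ) = orbit-edge cycᵥ t in
          e , ¬-not (λ Xf → none-missing (fromℕ< t<q , subst (λ k → X (edgeₜ k) ≡ false)
                                                               (sym (Fin.toℕ-fromℕ< t<q)) Xf))
            , srcₑ , tgtₑ

    linearForest⇒respectsClasses : RespectsClasses X
    linearForest⇒respectsClasses c = bounded (kind c)
      where
      bounded : (k : Kind c) → ClassBounded X c k
      bounded (loop loop′) (e , e∈c) =
        ¬-not λ Xe → loop′ (subst NonLoop (∼-loop loop′ (in-class e∈c)) (loop-free Xe))
      bounded (offCycle off) (e , e∈c) (e′ , e′∈c) Xe Xe′ =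
        fibre-≡ (offCycle-class-unique off (in-class e∈c) (rep≡⇒∼ (trans e∈c (sym e′∈c))) Xe Xe′)
      bounded (cyclic cyc) (e₀ , e₀∈c) = let (e , c∼e , Xf) = cyclic-class-incomplete cyc in
        (e , trans (∼⇒rep≡ (∼-sym c∼e)) (trans (sym (∼⇒rep≡ (in-class e₀∈c))) e₀∈c)) , Xf

  module _ {X : Fin nE → Bool} (respects : RespectsClasses X) where

    respects-loop-free : ∀ {e} → X e ≡ true → NonLoop e
    respects-loop-free {e} Xe = nonLoop (kind (rep e)) (respects (rep e))
      where
      nonLoop : (k : Kind (rep e)) → ClassBounded X (rep e) k → NonLoop e
      nonLoop (loop _)       all-false = contradiction (trans (sym Xe) (all-false (e , refl))) λ ()
      nonLoop (cyclic cyc)   _         = ∼-NonLoop (∼rep e) (proj₁ cyc)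
      nonLoop (offCycle off) _         = ∼-NonLoop (∼rep e) (proj₁ off)

    respects-share : ∀ {e e′} → OffCycle e → OffCycle e′ → ShareEndpoint e e′ →
                     X e ≡ true → X e′ ≡ true → e ≡ e′
    respects-share {e} {e′} off off′ share Xe Xe′ = unique (kind (rep e)) (respects (rep e))
      where
      unique : (k : Kind (rep e)) → ClassBounded X (rep e) k → e ≡ e′
      unique (offCycle _) at-most-one =
        cong proj₁ (at-most-one (e , refl) (e′ , sym (∼⇒rep≡ (inj₂ (inj₁ (off , off′ , share))))) Xe Xe′)
      unique (loop loop′) _           = contradiction (proj₁ (∼-OffCycle (∼rep e) off)) loop′
      unique (cyclic cyc) _           = contradiction (proj₂ cyc) (proj₂ (∼-OffCycle (∼rep e) off))

    respects-src-injective : ∀ {e e′} → X e ≡ true → X e′ ≡ true → src e ≡ src e′ → e ≡ e′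
    respects-src-injective {e} {e′} Xe Xe′ src≡ with onCycle? (src e)
    ... | yes cyc = sym (onCycle-src-unique cyc (respects-loop-free Xe) (sym src≡))
    ... | no ¬cyc = respects-share (respects-loop-free Xe , ¬cyc)
                                   (respects-loop-free Xe′ , ¬cyc ∘ subst OnCycle (sym src≡)) (inj₁ src≡) Xe Xe′

    respects-tgt-injective : ∀ {e e′} → X e ≡ true → X e′ ≡ true → tgt e ≡ tgt e′ → e ≡ e′
    respects-tgt-injective {e} {e′} Xe Xe′ tgt≡ with onCycle? (src e) | onCycle? (src e′)
    ... | yes cyc  | _         = sym (onCycle-tgt-unique cyc (respects-loop-free Xe) (sym tgt≡))
    ... | no _     | yes cyc′  = onCycle-tgt-unique cyc′ (respects-loop-free Xe′) tgt≡
    ... | no ¬cyc  | no ¬cyc′  =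
      respects-share (respects-loop-free Xe , ¬cyc) (respects-loop-free Xe′ , ¬cyc′) (inj₂ tgt≡) Xe Xe′

    -- A closed X-walk contains a cycle; by MP2 its edges form a whole class, all of them in X.
    respects-acyclic : Acyclic X
    respects-acyclic g 0<q steps closed = incomplete (kind (rep e₀)) (respects (rep e₀))
      where
      cycle-seq = closedWalk⇒cycleSeq respects-loop-free respects-src-injective g 0<q steps closed
      C = proj₁ (proj₂ cycle-seq)
      X-steps = proj₂ (proj₂ cycle-seq)
      e₀ = proj₁ (X-steps 0 z<s)
      src₀ : src e₀ ≡ g 0
      src₀ = proj₁ (proj₂ (proj₂ (X-steps 0 z<s)))
      cyc₀ : Cyclic e₀
      cyc₀ = respects-loop-free (proj₁ (proj₂ (X-steps 0 z<s))) , subst OnCycle (sym src₀) (cycleSeq-onCycle C)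
      incomplete : (k : Kind (rep e₀)) → ClassBounded X (rep e₀) k → ⊥
      incomplete (cyclic _) some-false =
        let ((e , same-class) , Xf) = some-false (e₀ , refl)
            (t , t<2+len , srcₑ) = cycleSeq-class C src₀ cyc₀ (∼-sym (rep≡⇒∼ same-class))
        in contradiction (trans (sym (cycleSeq-edge C X-steps t<2+len srcₑ)) Xf) λ ()
      incomplete (loop loop′)   _ = contradiction (proj₁ (∼-Cyclic (∼rep e₀) cyc₀)) loop′
      incomplete (offCycle off) _ = contradiction (proj₂ (∼-Cyclic (∼rep e₀) cyc₀)) (proj₂ off)

    respectsClasses⇒linearForest : IsLinearForest X
    respectsClasses⇒linearForest = record
      { src-injective = respects-src-injective
      ; tgt-injective = respects-tgt-injective
      ; acyclic       = respects-acyclic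
      }

  linearForest⇔respectsClasses : ∀ {X} → IsLinearForest X ⇔ RespectsClasses X
  linearForest⇔respectsClasses = mk⇔ linearForest⇒respectsClasses respectsClasses⇒linearForest

  classRank : Fin nE → ℕ
  classRank c = rank (kindRank (kind c)) (size c)

  respectsClasses⇔independent : ∀ (Y : Σ (Fin nE) (Fin ∘ size) → Bool) →
    RespectsClasses (Y ∘ Inverse.to partition) ⇔ (∀ c → card (λ x → Y (c , x)) ≤ classRank c)
  respectsClasses⇔independent Y = mk⇔ (λ respects c → Equivalence.to (per-class c) (respects c))
                                      (λ independent c → Equivalence.from (per-class c) (independent c))
    where
    per-class : ∀ c → ClassBounded (Y ∘ Inverse.to partition) c (kind c) ⇔ card (λ x → Y (c , x)) ≤ classRank c
    per-class c = ⇔-sym (card≤rank⇔Bounded (kindRank (kind c)) (λ x → Y (c , x)))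
                  ⇔-∘ Bounded-↔ (kindRank (kind c)) (fibre↔ c) (cong Y ∘ partition-fibre c)

theorem4p24 : (G : Digraph) → IsMPDigraph G →
    ∃[ r ] Σ (Fin r → ℕ) λ k → Σ (Fin r → ℕ) λ n →
    multipathMatroid G ≅ directSum (λ i → uniform (k i) (n i))
theorem4p24 G mp = Digraph.nE G , classRank , size , partition , λ Y →
  respectsClasses⇔independent Y ⇔-∘ (linearForest⇔respectsClasses ⇔-∘ multipath⇔linearForest)
  where
  open LinearForests G using (multipath⇔linearForest)
  open EdgeClasses G mp
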